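{- Let $\mathfrak{U}$ be a set and let $\mathcal{B}\subseteq\mathcal{P}(\mathfrak{U})\setminus\{\emptyset\}$ be a directed family with $\mathfrak{U}\in\mathcal{B}$. The following are equivalent: (1) $\mathcal{B}$ is unpackable. (2) If $A,B_1,\dots,B_n$ are balls with $A\subseteq\bigcup_{i=1}^n B_i$, then $A\subseteq B_i$ for some $i$. (3) Whenever $S=A_1\setminus(B_{1,1}\cup\dots\cup B_{1,m})=A_2\setminus(B_{2,1}\cup\dots\cup B_{2,n})$ is a swiss cheese (given by both presentations) and $B_{i,j}\cap B_{i,k}=\emptyset$ for $i\in\{1,2\}$ and $j\neq k$, then $A_1=A_2$ and $\{B_{1,1},\dots,B_{1,m}\}=\{B_{2,1},\dots,B_{2,n}\}$. (4) Every constructible set $X\subseteq\mathfrak{U}$ admits a unique swiss cheese decomposition.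
   Context: A family $\mathcal{B}\subseteq\mathcal{P}(\mathfrak{U})\setminus\{\emptyset\}$ is directed if for all $B_0,B_1\in\mathcal{B}$ one has $B_0\subseteq B_1$, $B_1\subseteq B_0$, or $B_0\cap B_1=\emptyset$. Members of $\mathcal{B}$ are called balls; a constructible set is a finite boolean combination of balls. $\mathcal{B}$ is unpackable if no ball is a finite union of balls properly contained in it. A swiss cheese is a set of the form $S=A\setminus(B_1\cup\dots\cup B_n)$ where $A$ is a ball and $B_1,\dots,B_n\subsetneq A$ are balls properly contained in $A$ ($n=0$ allowed), with $B_i\not\subseteq B_j$ for $i\neq j$; $A$ is a wheel and the $B_i$ are holes (relative to the presentation). A swiss cheese decomposition of $X$ is a finite collection of swiss cheeses $S_1,\dots,S_n$ ($n=0$ allowed) such that (i) $S_i\cap S_j=\emptyset$ for $i\neq j$, (ii) no wheel of any $S_i$ equals a hole of any $S_j$, and (iii) $X=S_1\cup\dots\cup S_n$. -}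

module Defs where

open import Level using (0ℓ)
open import Data.Nat using (ℕ)
open import Data.Fin using (Fin)
open import Data.Product using (Σ; ∃; _×_; _,_)
open import Data.Sum using (_⊎_)
open import Relation.Nullary using (¬_)
open import Relation.Binary.PropositionalEquality using (_≡_)
open import Relation.Unary
  using (Pred; _∈_; _∉_; _⊆_; _⊂_; _≐_; _⊥_; _∩_; _∪_; _∖_; ∁; ⋃; U)

-- A family of subsets of the set 𝔘, given as an indexed family
-- ball : I → Pred 𝔘 0ℓ  (the family ℬ is the image of ball).
-- Equality of sets is always extensional (_≐_).
module Balls {𝔘 I : Set} (ball : I → Pred 𝔘 0ℓ) where

  ⋃Balls : {n : ℕ} → (Fin n → I) → Pred 𝔘 0ℓ
  ⋃Balls {n} bs = ⋃ (Fin n) (λ k → ball (bs k))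

  NonemptyBalls : Set
  NonemptyBalls = ∀ i → ∃ λ x → x ∈ ball i

  Directed : Set
  Directed = ∀ i j → (ball i ⊆ ball j) ⊎ (ball j ⊆ ball i) ⊎ (ball i ⊥ ball j)

  UniverseIsBall : Set
  UniverseIsBall = ∃ λ i → ball i ≐ U

  Unpackable : Set
  Unpackable = ∀ (a : I) (n : ℕ) (bs : Fin n → I) →
    (∀ k → ball (bs k) ⊂ ball a) → ¬ (ball a ≐ ⋃Balls bs)

  CoverProperty : Set
  CoverProperty = ∀ (a : I) (n : ℕ) (bs : Fin n → I) →
    ball a ⊆ ⋃Balls bs → ∃ λ k → ball a ⊆ ball (bs k)

  record Cheese : Set where
    field
      wheel   : I
      nholes  : ℕ
      hole    : Fin nholes → I
      proper  : ∀ k → ball (hole k) ⊂ ball wheel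
      incomp  : ∀ j k → ¬ (j ≡ k) → ¬ (ball (hole j) ⊆ ball (hole k))
  open Cheese public

  ⟦_⟧ᶜ : Cheese → Pred 𝔘 0ℓ
  ⟦ S ⟧ᶜ = ball (wheel S) ∖ ⋃Balls (hole S)

  DisjointHoles : Cheese → Set
  DisjointHoles S = ∀ j k → ¬ (j ≡ k) → ball (hole S j) ⊥ ball (hole S k)

  PresentationUnique : Set
  PresentationUnique = ∀ (S T : Cheese) → ⟦ S ⟧ᶜ ≐ ⟦ T ⟧ᶜ →
    DisjointHoles S → DisjointHoles T →
    (ball (wheel S) ≐ ball (wheel T))
    × (∀ j → ∃ λ k → ball (hole S j) ≐ ball (hole T k))
    × (∀ k → ∃ λ j → ball (hole T k) ≐ ball (hole S j))

  data BExp : Set where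
    atom  : I → BExp
    compl : BExp → BExp
    _∪ᵉ_  : BExp → BExp → BExp
    _∩ᵉ_  : BExp → BExp → BExp

  ⟦_⟧ᵉ : BExp → Pred 𝔘 0ℓ
  ⟦ atom i ⟧ᵉ  = ball i
  ⟦ compl e ⟧ᵉ = ∁ ⟦ e ⟧ᵉ
  ⟦ e ∪ᵉ f ⟧ᵉ  = ⟦ e ⟧ᵉ ∪ ⟦ f ⟧ᵉ
  ⟦ e ∩ᵉ f ⟧ᵉ  = ⟦ e ⟧ᵉ ∩ ⟦ f ⟧ᵉ

  Constructible : Pred 𝔘 0ℓ → Set
  Constructible X = ∃ λ e → X ≐ ⟦ e ⟧ᵉ

  record Decomposition (X : Pred 𝔘 0ℓ) : Set where
    field
      size      : ℕ
      piece     : Fin size → Cheese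
      disjoint  : ∀ i j → ¬ (i ≡ j) → ⟦ piece i ⟧ᶜ ⊥ ⟦ piece j ⟧ᶜ
      wheel≠hole : ∀ i j k → ¬ (ball (wheel (piece i)) ≐ ball (hole (piece j) k))
      covers    : X ≐ ⋃ (Fin size) (λ i → ⟦ piece i ⟧ᶜ)
  open Decomposition public

  SameCheeses : {X : Pred 𝔘 0ℓ} → Decomposition X → Decomposition X → Set
  SameCheeses D E =
    (∀ i → ∃ λ j → ⟦ piece D i ⟧ᶜ ≐ ⟦ piece E j ⟧ᶜ)
    × (∀ j → ∃ λ i → ⟦ piece E j ⟧ᶜ ≐ ⟦ piece D i ⟧ᶜ)

  UniqueDecomposition : Set₁
  UniqueDecomposition = ∀ (X : Pred 𝔘 0ℓ) → Constructible X →
    Decomposition X × (∀ (D E : Decomposition X) → SameCheeses D E)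

-- Call a set small in ball a if it is covered by finitely many balls not containing a.
-- Unpackability is the cover property (2), i.e. no ball is small in itself, and then no swiss
-- cheese is small in its wheel: a cheese determines its wheel and its holes (3).  Given a
-- decomposition of X, up to small sets X contains every ball below a wheel through a point of
-- its piece, and avoids every hole as well as some ball between a wheel and any larger ball; so
-- the wheels, and then the pieces, are determined by X.  A constructible set is a union of atoms
-- of finitely many balls; for a minimal one C, X contains all of C or none of it, and
-- decompositions survive adding or removing a ball, which gives existence.  Conversely a ball
-- packed by incomparable proper sub-balls has two presentations and two decompositions.
module Submission where

open import Defs
open import Level using (0ℓ)
open import Data.Empty using (⊥-elim)
open import Data.Fin using (Fin; zero; suc; punchIn; punchOut; _↑ˡ_; _↑ʳ_)
open import Data.Fin.Properties using (_≟_; suc-injective; punchIn-punchOut)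
open import Data.Nat using (ℕ; zero; suc; _+_)
open import Data.Product as Product using (∃; ∃₂; _×_; _,_; proj₁; proj₂; swap)
open import Data.Sum as Sum using (_⊎_; inj₁; inj₂)
open import Data.Vec.Functional using (_∷_; _++_)
open import Data.Vec.Functional.Properties using (lookup-++ˡ; lookup-++ʳ)
open import Data.Vec.Functional.Relation.Unary.All using (All)
open import Data.Vec.Functional.Relation.Unary.All.Properties using (++⁺; ++⁻)
open import Function using (_∘_)
open import Function.Bundles using (_⇔_; mk⇔)
open import Function.Definitions using (Injective)
open import Relation.Binary.PropositionalEquality using (_≡_; _≢_; refl; sym; cong; subst)
open import Relation.Nullary using (¬_; Dec; yes; no)
open import Relation.Unary
  using (Pred; Decidable; _∈_; _∉_; _⊆_; _⊂_; _≐_; _⊥_; _∩_; _∪_; _∖_; ⋃; ∅)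
open import Relation.Unary.Properties using (≐-refl; ≐-sym)
open import Axiom.ExcludedMiddle using (ExcludedMiddle)
open import Axiom.DoubleNegationElimination using (em⇒dne)

record Enumeration {n : ℕ} (P : Pred (Fin n) 0ℓ) : Set where
  field
    count     : ℕ
    index     : Fin count → Fin n
    injective : Injective _≡_ _≡_ index
    sound     : ∀ a → P (index a)
    complete  : ∀ {k} → P k → ∃ λ a → index a ≡ k

enumerate : {n : ℕ} {P : Pred (Fin n) 0ℓ} → Decidable P → Enumeration P
enumerate {zero} P? = record
  { count = 0 ; index = λ () ; injective = λ { {()} } ; sound = λ () ; complete = λ { {()} } }
enumerate {suc n} {P} P? with enumerate (P? ∘ suc) | P? zero
... | E | no ¬p₀ = record
  { count = count ; index = suc ∘ index ; injective = injective ∘ suc-injective ; sound = sound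
  ; complete = λ { {zero} p → ⊥-elim (¬p₀ p) ; {suc k} p → Product.map₂ (cong suc) (complete p) } }
  where open Enumeration E
... | E | yes p₀ = record
  { count = suc count ; index = zero ∷ suc ∘ index
  ; injective = λ { {zero} {zero} _ → refl
                  ; {suc a} {suc b} e → cong suc (injective (suc-injective e)) }
  ; sound = λ { zero → p₀ ; (suc a) → sound a }
  ; complete = λ { {zero} _ → zero , refl
                 ; {suc k} p → Product.map suc (cong suc) (complete p) } }
  where open Enumeration E

module DirectedBalls (lem : ExcludedMiddle 0ℓ) {𝔘 I : Set} (ball : I → Pred 𝔘 0ℓ)
  (dir : Balls.Directed ball) where
  open Balls ball

  dne : {P : Set} → ¬ ¬ P → P
  dne = em⇒dne lem

  comparable : ∀ {i j x} → x ∈ ball i → x ∈ ball j → ball i ⊆ ball j ⊎ ball j ⊆ ball i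
  comparable {i} {j} xi xj with dir i j
  ... | inj₁ i⊆j = inj₁ i⊆j
  ... | inj₂ (inj₁ j⊆i) = inj₂ j⊆i
  ... | inj₂ (inj₂ i⊥j) = ⊥-elim (i⊥j (xi , xj))

  Incomparable : {n : ℕ} → (Fin n → I) → Set
  Incomparable bs = ∀ j k → j ≢ k → ¬ ball (bs j) ⊆ ball (bs k)

  incomparable⇒disjoint : {n : ℕ} {bs : Fin n → I} → Incomparable bs →
    ∀ j k → j ≢ k → ball (bs j) ⊥ ball (bs k)
  incomparable⇒disjoint inc j k j≢k (xj , xk) with comparable xj xk
  ... | inj₁ j⊆k = inc j k j≢k j⊆k
  ... | inj₂ k⊆j = inc k j (j≢k ∘ sym) k⊆j

  cover⇒unpackable : CoverProperty → Unpackable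
  cover⇒unpackable cover a n bs bs⊂a (a⊆⋃ , _) =
    let k , a⊆bₖ = cover a n bs a⊆⋃ in proj₂ (bs⊂a k) a⊆bₖ

  unpackable⇒cover : Unpackable → CoverProperty
  unpackable⇒cover unpackable a n bs a⊆⋃ with lem {∃ λ k → ball a ⊆ ball (bs k)}
  ... | yes found = found
  ... | no none = ⊥-elim (unpackable a count (bs ∘ index) inner⊂a (a⊆inner , λ (k , x) → sound k x))
    where
    open Enumeration (enumerate {P = λ k → ball (bs k) ⊆ ball a} (λ _ → lem))
    inner⊂a : ∀ k → ball (bs (index k)) ⊂ ball a
    inner⊂a k = sound k , λ a⊆ → none (index k , a⊆)
    a⊆inner : ball a ⊆ ⋃Balls (bs ∘ index)
    a⊆inner xa with a⊆⋃ xa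
    ... | k , xb with comparable xa xb
    ...   | inj₁ a⊆b = ⊥-elim (none (k , a⊆b))
    ...   | inj₂ b⊆a = let i , i↦k = complete b⊆a in i , subst (λ l → _ ∈ ball (bs l)) (sym i↦k) xb

  -- Under the cover property ball a itself is not small: small sets are negligible in ball a.
  Small : I → Pred 𝔘 0ℓ → Set
  Small a P = ∃₂ λ n (bs : Fin n → I) → All (λ b → ¬ ball a ⊆ ball b) bs × P ⊆ ⋃Balls bs

  ∅-small : ∀ {a} → Small a ∅
  ∅-small = 0 , (λ ()) , (λ ()) , λ ()

  ball-small : ∀ {a b} → ¬ ball a ⊆ ball b → Small a (ball b)
  ball-small {b = b} a⊈b = 1 , (λ _ → b) , (λ _ → a⊈b) , (zero ,_)

  small-⊆ : ∀ {a P Q} → P ⊆ Q → Small a Q → Small a P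
  small-⊆ P⊆Q (n , bs , a⊈bs , Q⊆⋃) = n , bs , a⊈bs , Q⊆⋃ ∘ P⊆Q

  small-∪ : ∀ {a P Q} → Small a P → Small a Q → Small a (P ∪ Q)
  small-∪ {a} (n , bs , a⊈bs , P⊆⋃) (m , cs , a⊈cs , Q⊆⋃) =
    n + m , bs ++ cs , ++⁺ (λ b → ¬ ball a ⊆ ball b) a⊈bs a⊈cs ,
    Sum.[ inˡ ∘ P⊆⋃ , inʳ ∘ Q⊆⋃ ]
    where
    inˡ : ⋃Balls bs ⊆ ⋃Balls (bs ++ cs)
    inˡ (k , x) = k ↑ˡ m , subst (λ b → _ ∈ ball b) (sym (lookup-++ˡ bs cs k)) x
    inʳ : ⋃Balls cs ⊆ ⋃Balls (bs ++ cs)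
    inʳ (k , x) = n ↑ʳ k , subst (λ b → _ ∈ ball b) (sym (lookup-++ʳ bs cs k)) x

  small-⋃ : ∀ {a} n (P : Fin n → Pred 𝔘 0ℓ) → (∀ i → Small a (P i)) → Small a (⋃ (Fin n) P)
  small-⋃ zero P _ = small-⊆ (λ ()) ∅-small
  small-⋃ (suc n) P small = small-⊆ split (small-∪ (small zero) (small-⋃ n (P ∘ suc) (small ∘ suc)))
    where
    split : ⋃ (Fin (suc n)) P ⊆ P zero ∪ ⋃ (Fin n) (P ∘ suc)
    split (zero , x) = inj₁ x
    split (suc i , x) = inj₂ (i , x)

  holes-small : ∀ S → Small (wheel S) (⋃Balls (hole S))
  holes-small S = nholes S , hole S , (λ k → proj₂ (proper S k)) , λ x → x

  noHoles : I → Cheese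
  noHoles a = record { wheel = a ; nholes = 0 ; hole = λ () ; proper = λ () ; incomp = λ () }

  noHoles-≐ : ∀ a → ⟦ noHoles a ⟧ᶜ ≐ ball a
  noHoles-≐ a = proj₁ , (_, λ ())

  holesOutside : (c : I) (S : Cheese) → Enumeration (λ k → ¬ ball (hole S k) ⊆ ball c)
  holesOutside c S = enumerate (λ _ → lem)

  fill : I → Cheese → Cheese
  fill c S = record
    { wheel = wheel S ; nholes = count ; hole = hole S ∘ index ; proper = proper S ∘ index
    ; incomp = λ a b a≢b → incomp S (index a) (index b) (a≢b ∘ injective) }
    where open Enumeration (holesOutside c S)

  module _ (c : I) (S : Cheese) where
    open Enumeration (holesOutside c S)

    fill-holes : ∀ (Q : Pred I 0ℓ) → All Q (hole S) → All Q (hole (fill c S))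
    fill-holes Q q = q ∘ index

    fill-holes-outside : All (λ h → ¬ ball h ⊆ ball c) (hole (fill c S))
    fill-holes-outside = sound

    ⊆-fill : ⟦ S ⟧ᶜ ⊆ ⟦ fill c S ⟧ᶜ
    ⊆-fill (xw , x∉h) = xw , λ (a , xa) → x∉h (index a , xa)

    ∈-fill⇒hole-⊆ : ∀ {y} k → y ∈ ⟦ fill c S ⟧ᶜ → y ∈ ball (hole S k) → ball (hole S k) ⊆ ball c
    ∈-fill⇒hole-⊆ {y} k (_ , y∉h) yh = dne λ h⊈c →
      let a , a↦k = complete h⊈c in y∉h (a , subst (λ l → y ∈ ball (hole S l)) (sym a↦k) yh)

    fill-⊆ : ⟦ fill c S ⟧ᶜ ⊆ ⟦ S ⟧ᶜ ∪ ball c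
    fill-⊆ {y} yp with lem {y ∈ ⋃Balls (hole S)}
    ... | yes (k , yh) = inj₂ (∈-fill⇒hole-⊆ k yp yh yh)
    ... | no y∉h = inj₁ (proj₁ yp , y∉h)

  punch : (S : Cheese) (c : I) → ball c ⊂ ball (wheel S) →
    All (λ h → ¬ ball c ⊆ ball h) (hole S) → All (λ h → ¬ ball h ⊆ ball c) (hole S) → Cheese
  punch S c c⊂W c⊈h h⊈c = record
    { wheel = wheel S ; nholes = suc (nholes S) ; hole = c ∷ hole S
    ; proper = λ { zero → c⊂W ; (suc k) → proper S k }
    ; incomp = λ { zero zero 0≢0 → ⊥-elim (0≢0 refl)
                 ; zero (suc k) _ → c⊈h k
                 ; (suc j) zero _ → h⊈c j
                 ; (suc j) (suc k) j≢k → incomp S j k (j≢k ∘ cong suc) } }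

  punch-≐ : ∀ S c c⊂W c⊈h h⊈c → ⟦ punch S c c⊂W c⊈h h⊈c ⟧ᶜ ≐ ⟦ S ⟧ᶜ ∖ ball c
  punch-≐ S c _ _ _ =
    (λ (xw , x∉h) → (xw , x∉h ∘ Product.map suc (λ xh → xh)) , x∉h ∘ (zero ,_)) ,
    λ ((xw , x∉h) , x∉c) → xw , λ { (zero , xc) → x∉c xc ; (suc k , xh) → x∉h (k , xh) }

  carve : (S : Cheese) (c : I) →
    Dec (ball c ⊂ ball (wheel S) × All (λ h → ¬ ball c ⊆ ball h) (hole S)) → Cheese
  carve S c (yes (c⊂W , c⊈h)) =
    punch (fill c S) c c⊂W (fill-holes c S (λ h → ¬ ball c ⊆ ball h) c⊈h) (fill-holes-outside c S)
  carve S c (no _) = S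

  carve-wheel : ∀ S c d → wheel (carve S c d) ≡ wheel S
  carve-wheel S c (yes _) = refl
  carve-wheel S c (no _) = refl

  carve-holes : ∀ S c d (Q : Pred I 0ℓ) → Q c → All Q (hole S) → All Q (hole (carve S c d))
  carve-holes S c (yes _) Q qc q = λ { zero → qc ; (suc k) → fill-holes c S Q q k }
  carve-holes S c (no _) Q qc q = q

  carve-≐ : ∀ S c d → ¬ ball (wheel S) ⊆ ball c → ⟦ carve S c d ⟧ᶜ ≐ ⟦ S ⟧ᶜ ∖ ball c
  carve-≐ S c (yes (c⊂W , c⊈h)) _
    with punch-≐ (fill c S) c c⊂W (fill-holes c S (λ h → ¬ ball c ⊆ ball h) c⊈h)
                 (fill-holes-outside c S)
  ... | ⊆∖ , ∖⊆ = (λ xs → let xf , x∉c = ⊆∖ xs in outside-c x∉c (fill-⊆ c S xf) , x∉c)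
                , λ (xS , x∉c) → ∖⊆ (⊆-fill c S xS , x∉c)
    where
    outside-c : ∀ {x} → x ∉ ball c → x ∈ ⟦ S ⟧ᶜ ∪ ball c → x ∈ ⟦ S ⟧ᶜ
    outside-c _ (inj₁ xS) = xS
    outside-c x∉c (inj₂ xc) = ⊥-elim (x∉c xc)
  carve-≐ S c (no ¬carved) W⊈c = (λ xs → xs , x∉c xs) , proj₁
    where
    x∉c : ∀ {x} → x ∈ ⟦ S ⟧ᶜ → x ∉ ball c
    x∉c xs xc with comparable (proj₁ xs) xc
    ... | inj₁ W⊆c = W⊈c W⊆c
    ... | inj₂ c⊆W =
          let k , c⊆h = dne λ none → ¬carved ((c⊆W , W⊈c) , λ k c⊆h → none (k , c⊆h))
          in proj₂ xs (k , c⊆h xc)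

  Decomposition-resp-≐ : ∀ {X X′} → X ≐ X′ → Decomposition X → Decomposition X′
  Decomposition-resp-≐ (X⊆X′ , X′⊆X) D = record
    { size = size D ; piece = piece D ; disjoint = disjoint D ; wheel≠hole = wheel≠hole D
    ; covers = proj₁ (covers D) ∘ X′⊆X , X⊆X′ ∘ proj₂ (covers D) }

  disjoint-balls-decomposition : ∀ {n} (bs : Fin n → I) →
    (∀ j k → j ≢ k → ball (bs j) ⊥ ball (bs k)) → Decomposition (⋃Balls bs)
  disjoint-balls-decomposition bs bs-disjoint = record
    { size = _ ; piece = noHoles ∘ bs
    ; disjoint = λ j k j≢k (xj , xk) → bs-disjoint j k j≢k (proj₁ xj , proj₁ xk)
    ; wheel≠hole = λ _ _ ()
    ; covers = Product.map₂ (proj₂ (noHoles-≐ _)) , Product.map₂ proj₁ }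

  ball-decomposition : ∀ a → Decomposition (ball a)
  ball-decomposition a = Decomposition-resp-≐ (proj₂ , (zero ,_))
    (disjoint-balls-decomposition {1} (λ _ → a) λ { zero zero 0≢0 → ⊥-elim (0≢0 refl) })

  SameBalls : 𝔘 → 𝔘 → Pred I 0ℓ
  SameBalls x y b = (x ∈ ball b → y ∈ ball b) × (y ∈ ball b → x ∈ ball b)

  sameBalls-sym : ∀ {n} {L : Fin n → I} {x y} → All (SameBalls x y) L → All (SameBalls y x) L
  sameBalls-sym same = swap ∘ same

  sameBalls-trans : ∀ {n} {L : Fin n → I} {x y z} →
    All (SameBalls x y) L → All (SameBalls y z) L → All (SameBalls x z) L
  sameBalls-trans xy yz k = proj₁ (yz k) ∘ proj₁ (xy k) , proj₂ (xy k) ∘ proj₂ (yz k)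

  sameBalls-punchIn : ∀ {m} (L : Fin (suc m) → I) j {x y} → x ∉ ball (L j) → y ∉ ball (L j) →
    All (SameBalls x y) (L ∘ punchIn j) → All (SameBalls x y) L
  sameBalls-punchIn L j x∉ y∉ same k with j ≟ k
  ... | yes refl = ⊥-elim ∘ x∉ , ⊥-elim ∘ y∉
  ... | no j≢k = subst (SameBalls _ _ ∘ L) (punchIn-punchOut j≢k) (same (punchOut j≢k))

  -- X is a union of atoms of the boolean algebra generated by the balls of L
  Determined : {m : ℕ} → (Fin m → I) → Pred 𝔘 0ℓ → Set
  Determined L X = ∀ {x y} → All (SameBalls x y) L → x ∈ X → y ∈ X

  atomCount : BExp → ℕ
  atomCount (atom i) = 1
  atomCount (compl e) = atomCount e
  atomCount (e ∪ᵉ f) = atomCount e + atomCount f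
  atomCount (e ∩ᵉ f) = atomCount e + atomCount f

  atoms : (e : BExp) → Fin (atomCount e) → I
  atoms (atom i) _ = i
  atoms (compl e) = atoms e
  atoms (e ∪ᵉ f) = atoms e ++ atoms f
  atoms (e ∩ᵉ f) = atoms e ++ atoms f

  ⟦⟧ᵉ-determined : ∀ e → Determined (atoms e) ⟦ e ⟧ᵉ
  ⟦⟧ᵉ-determined (atom i) same = proj₁ (same zero)
  ⟦⟧ᵉ-determined (compl e) same x∉e y∈e = x∉e (⟦⟧ᵉ-determined e (sameBalls-sym same) y∈e)
  ⟦⟧ᵉ-determined (e ∪ᵉ f) {x} {y} same with ++⁻ (SameBalls x y) (atoms e) same
  ... | sameᵉ , sameᶠ = Sum.map (⟦⟧ᵉ-determined e sameᵉ) (⟦⟧ᵉ-determined f sameᶠ)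
  ⟦⟧ᵉ-determined (e ∩ᵉ f) {x} {y} same with ++⁻ (SameBalls x y) (atoms e) same
  ... | sameᵉ , sameᶠ = Product.map (⟦⟧ᵉ-determined e sameᵉ) (⟦⟧ᵉ-determined f sameᶠ)

  minimal : ∀ m (L : Fin (suc m) → I) → ∃ λ j → ∀ k → ¬ ball (L k) ⊂ ball (L j)
  minimal zero L = zero , λ { zero (0⊆0 , 0⊈0) → 0⊈0 0⊆0 }
  minimal (suc m) L with minimal m (L ∘ suc)
  ... | j , min with lem {ball (L zero) ⊂ ball (L (suc j))}
  ...   | no 0⊄j = suc j , λ { zero → 0⊄j ; (suc k) → min k }
  ...   | yes (0⊆j , j⊈0) = zero , λ
    { zero (0⊆0 , 0⊈0) → 0⊈0 0⊆0
    ; (suc k) (k⊆0 , 0⊈k) → min k (0⊆j ∘ k⊆0 , λ j⊆k → 0⊈k (j⊆k ∘ 0⊆j)) }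

  module _ (cover : CoverProperty) where

    ball-not-small : ∀ a → ¬ Small a (ball a)
    ball-not-small a (n , bs , a⊈bs , a⊆⋃) = let k , a⊆b = cover a n bs a⊆⋃ in a⊈bs k a⊆b

    cheese-not-small : ∀ S → ¬ Small (wheel S) ⟦ S ⟧ᶜ
    cheese-not-small S small =
      ball-not-small (wheel S) (small-⊆ split (small-∪ (holes-small S) small))
      where
      split : ball (wheel S) ⊆ ⋃Balls (hole S) ∪ ⟦ S ⟧ᶜ
      split {x} xw with lem {x ∈ ⋃Balls (hole S)}
      ... | yes xh = inj₁ xh
      ... | no x∉h = inj₂ (xw , x∉h)

    cheese-nonempty : ∀ S → ∃ λ x → x ∈ ⟦ S ⟧ᶜ
    cheese-nonempty S = dne λ empty → cheese-not-small S (small-⊆ (λ xs → empty (_ , xs)) ∅-small)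

    cheese-cover : ∀ S {n} (bs : Fin n → I) → ⟦ S ⟧ᶜ ⊆ ⋃Balls bs →
      ∃ λ k → ball (wheel S) ⊆ ball (bs k)
    cheese-cover S bs S⊆⋃ = dne λ none → cheese-not-small S (_ , bs , (λ k → none ∘ (k ,_)) , S⊆⋃)

    cheese-⊆⇒wheel-⊆ : ∀ S {b} → ⟦ S ⟧ᶜ ⊆ ball b → ball (wheel S) ⊆ ball b
    cheese-⊆⇒wheel-⊆ S {b} S⊆b = proj₂ (cheese-cover S {1} (λ _ → b) ((zero ,_) ∘ S⊆b))

    cheese-≐⇒wheel-≐ : ∀ S T → ⟦ S ⟧ᶜ ≐ ⟦ T ⟧ᶜ → ball (wheel S) ≐ ball (wheel T)
    cheese-≐⇒wheel-≐ S T (S⊆T , T⊆S) =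
      cheese-⊆⇒wheel-⊆ S (proj₁ ∘ S⊆T) , cheese-⊆⇒wheel-⊆ T (proj₁ ∘ T⊆S)

    cheese-⊇⇒hole-⊆ : ∀ S T → ⟦ T ⟧ᶜ ⊆ ⟦ S ⟧ᶜ → ball (wheel S) ⊆ ball (wheel T) →
      ∀ j → ∃ λ k → ball (hole S j) ⊆ ball (hole T k)
    cheese-⊇⇒hole-⊆ S T T⊆S wS⊆wT j = cover (hole S j) (nholes T) (hole T) inHolesT
      where
      inHolesT : ball (hole S j) ⊆ ⋃Balls (hole T)
      inHolesT {y} yh = dne λ y∉h → proj₂ (T⊆S (wS⊆wT (proj₁ (proper S j) yh) , y∉h)) (j , yh)

    cheese-≐⇒hole-≐ : ∀ S T → ⟦ S ⟧ᶜ ≐ ⟦ T ⟧ᶜ → ∀ j → ∃ λ k → ball (hole S j) ≐ ball (hole T k)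
    cheese-≐⇒hole-≐ S T S≐T@(S⊆T , T⊆S) j with cheese-≐⇒wheel-≐ S T S≐T
    ... | wS⊆wT , wT⊆wS with cheese-⊇⇒hole-⊆ S T T⊆S wS⊆wT j
    ...   | k , j⊆k with cheese-⊇⇒hole-⊆ T S S⊆T wT⊆wS k
    ...     | j′ , k⊆j′ with j ≟ j′
    ...       | yes refl = k , j⊆k , k⊆j′
    ...       | no j≢j′ = ⊥-elim (incomp S j j′ j≢j′ (k⊆j′ ∘ j⊆k))

    presentation-unique : PresentationUnique
    presentation-unique S T S≐T _ _ =
      cheese-≐⇒wheel-≐ S T S≐T , cheese-≐⇒hole-≐ S T S≐T , cheese-≐⇒hole-≐ T S (≐-sym S≐T)

    wheel-inside-hole : ∀ S T → ⟦ S ⟧ᶜ ⊥ ⟦ T ⟧ᶜ → ball (wheel S) ⊆ ball (wheel T) →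
      ∃ λ k → ball (wheel S) ⊆ ball (hole T k)
    wheel-inside-hole S T S⊥T wS⊆wT =
      cheese-cover S (hole T) λ xs → dne λ x∉h → S⊥T (xs , wS⊆wT (proj₁ xs) , x∉h)

    AlmostContains AlmostAvoids : Pred 𝔘 0ℓ → I → Set
    AlmostContains X a = Small a (ball a ∖ X)
    AlmostAvoids X a = Small a (ball a ∩ X)

    ¬almostContains×almostAvoids : ∀ {X a} → AlmostContains X a → ¬ AlmostAvoids X a
    ¬almostContains×almostAvoids {X} {a} contains avoids =
      ball-not-small a (small-⊆ split (small-∪ contains avoids))
      where
      split : ball a ⊆ (ball a ∖ X) ∪ (ball a ∩ X)
      split {x} xa with lem {x ∈ X}
      ... | yes xX = inj₂ (xa , xX)
      ... | no x∉X = inj₁ (xa , x∉X)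

    module _ {X : Pred 𝔘 0ℓ} (D : Decomposition X) where
      private
        P : Fin (size D) → Cheese
        P = piece D
        W : Fin (size D) → Pred 𝔘 0ℓ
        W i = ball (wheel (P i))

      almostContains-below-wheel : ∀ i {x b} → x ∈ ⟦ P i ⟧ᶜ → x ∈ ball b → ball b ⊆ W i →
        AlmostContains X b
      almostContains-below-wheel i {x} {b} xs xb b⊆W =
        small-⊆ inHoles (nholes (P i) , hole (P i) , (λ k b⊆h → proj₂ xs (k , b⊆h xb)) , λ h → h)
        where
        inHoles : ball b ∖ X ⊆ ⋃Balls (hole (P i))
        inHoles (yb , y∉X) = dne λ y∉h → y∉X (proj₂ (covers D) (i , b⊆W yb , y∉h))

      almostAvoids-if-pieces-miss : ∀ {b} → (∀ i → ball b ⊆ W i → ⟦ P i ⟧ᶜ ∩ ball b ⊆ ∅) →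
        AlmostAvoids X b
      almostAvoids-if-pieces-miss {b} miss = small-⊆ split (small-⋃ (size D) _ small)
        where
        split : ball b ∩ X ⊆ ⋃ (Fin (size D)) (λ i → ⟦ P i ⟧ᶜ ∩ ball b)
        split (yb , yX) = let i , ys = proj₁ (covers D) yX in i , ys , yb
        small : ∀ i → Small b (⟦ P i ⟧ᶜ ∩ ball b)
        small i with lem {ball b ⊆ W i}
        ... | yes b⊆W = small-⊆ (miss i b⊆W) ∅-small
        ... | no b⊈W = small-⊆ (proj₁ ∘ proj₁) (ball-small b⊈W)

      hole-misses-pieces : ∀ j k i → ball (hole (P j) k) ⊆ W i → ⟦ P i ⟧ᶜ ∩ ball (hole (P j) k) ⊆ ∅
      hole-misses-pieces j k i K⊆Wi {y} (ys , yK) with i ≟ j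
      ... | yes refl = proj₂ ys (k , yK)
      ... | no i≢j with comparable (proj₁ ys) (proj₁ (proper (P j) k) yK)
      ...   | inj₂ Wj⊆Wi =
                let l , Wj⊆h = wheel-inside-hole (P j) (P i) (disjoint D j i (i≢j ∘ sym)) Wj⊆Wi
                in proj₂ ys (l , Wj⊆h (proj₁ (proper (P j) k) yK))
      ...   | inj₁ Wi⊆Wj with wheel-inside-hole (P i) (P j) (disjoint D i j i≢j) Wi⊆Wj
      ...     | l , Wi⊆h with k ≟ l
      ...       | yes refl = wheel≠hole D i j k (Wi⊆h , K⊆Wi)
      ...       | no k≢l = incomp (P j) k l k≢l (Wi⊆h ∘ K⊆Wi)

      almostAvoids-hole : ∀ j k → AlmostAvoids X (hole (P j) k)
      almostAvoids-hole j k = almostAvoids-if-pieces-miss (hole-misses-pieces j k)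

      almostAvoids-above-wheel : ∀ i {x b} → x ∈ ⟦ P i ⟧ᶜ → W i ⊂ ball b →
        ∃ λ b′ → W i ⊆ ball b′ × ball b′ ⊆ ball b × AlmostAvoids X b′
      almostAvoids-above-wheel i {x} {b} xs (Wi⊆b , b⊈Wi)
        with lem {∃₂ λ j k → W i ⊂ ball (hole (P j) k) × ball (hole (P j) k) ⊆ ball b}
      ... | yes (j , k , (Wi⊆h , _) , h⊆b) = hole (P j) k , Wi⊆h , h⊆b , almostAvoids-hole j k
      ... | no noHoleBetween = b , Wi⊆b , (λ y → y) , almostAvoids-if-pieces-miss miss
        where
        miss : ∀ j → ball b ⊆ W j → ⟦ P j ⟧ᶜ ∩ ball b ⊆ ∅
        miss j b⊆Wj {y} (ys , yb) with j ≟ i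
        ... | yes refl = b⊈Wi b⊆Wj
        ... | no j≢i with wheel-inside-hole (P i) (P j) (disjoint D i j (j≢i ∘ sym)) (b⊆Wj ∘ Wi⊆b)
        ...   | l , Wi⊆h with comparable (Wi⊆h (proj₁ xs)) (Wi⊆b (proj₁ xs))
        ...     | inj₁ h⊆b = noHoleBetween
                    (j , l , (Wi⊆h , λ h⊆Wi → wheel≠hole D i j l (Wi⊆h , h⊆Wi)) , h⊆b)
        ...     | inj₂ b⊆h = proj₂ ys (l , b⊆h yb)

    overlapping-wheel-⊇⇒⊆ : ∀ {X} (D E : Decomposition X) i j {x} →
      x ∈ ⟦ piece D i ⟧ᶜ → x ∈ ⟦ piece E j ⟧ᶜ →
      ball (wheel (piece E j)) ⊆ ball (wheel (piece D i)) →
      ball (wheel (piece D i)) ⊆ ball (wheel (piece E j))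
    overlapping-wheel-⊇⇒⊆ D E i j xs xt Wj⊆Wi = dne λ Wi⊈Wj →
      let b , Wj⊆b , b⊆Wi , avoids = almostAvoids-above-wheel E j xt (Wj⊆Wi , Wi⊈Wj)
      in ¬almostContains×almostAvoids
           (almostContains-below-wheel D i xs (Wj⊆b (proj₁ xt)) b⊆Wi) avoids

    overlapping-wheels-≐ : ∀ {X} (D E : Decomposition X) i j {x} →
      x ∈ ⟦ piece D i ⟧ᶜ → x ∈ ⟦ piece E j ⟧ᶜ →
      ball (wheel (piece D i)) ≐ ball (wheel (piece E j))
    overlapping-wheels-≐ D E i j xs xt with comparable (proj₁ xs) (proj₁ xt)
    ... | inj₁ Wi⊆Wj = Wi⊆Wj , overlapping-wheel-⊇⇒⊆ E D j i xt xs Wi⊆Wj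
    ... | inj₂ Wj⊆Wi = overlapping-wheel-⊇⇒⊆ D E i j xs xt Wj⊆Wi , Wj⊆Wi

    overlapping-piece-⊆ : ∀ {X} (D E : Decomposition X) i j {x} →
      x ∈ ⟦ piece D i ⟧ᶜ → x ∈ ⟦ piece E j ⟧ᶜ →
      ⟦ piece D i ⟧ᶜ ⊆ ⟦ piece E j ⟧ᶜ
    overlapping-piece-⊆ D E i j xs xt ys with overlapping-wheels-≐ D E i j xs xt
    ... | Wi⊆Wj , Wj⊆Wi = Wi⊆Wj (proj₁ ys) , λ (k , yh) →
      ¬almostContains×almostAvoids
        (almostContains-below-wheel D i ys yh (Wj⊆Wi ∘ proj₁ (proper (piece E j) k)))
        (almostAvoids-hole E j k)

    piece-≐-piece : ∀ {X} (D E : Decomposition X) i → ∃ λ j → ⟦ piece D i ⟧ᶜ ≐ ⟦ piece E j ⟧ᶜ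
    piece-≐-piece D E i =
      let x , xs = cheese-nonempty (piece D i)
          j , xt = proj₁ (covers E) (proj₂ (covers D) (i , xs))
      in j , overlapping-piece-⊆ D E i j xs xt , overlapping-piece-⊆ E D j i xt xs

    decomposition-unique : ∀ {X} (D E : Decomposition X) → SameCheeses D E
    decomposition-unique D E = piece-≐-piece D E , piece-≐-piece E D

    module _ {Y : Pred 𝔘 0ℓ} (D : Decomposition Y) (c : I) where
      private
        P : Fin (size D) → Cheese
        P = piece D
        open Enumeration (enumerate {P = λ i → ¬ ball (wheel (P i)) ⊆ ball c} (λ _ → lem))

        carved : Fin count → Cheese
        carved a = carve (P (index a)) c lem

        carved-≐ : ∀ a → ⟦ carved a ⟧ᶜ ≐ ⟦ P (index a) ⟧ᶜ ∖ ball c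
        carved-≐ a = carve-≐ (P (index a)) c lem (sound a)

        carved-wheel≠hole : ∀ a b k → ¬ (ball (wheel (carved a)) ≐ ball (hole (carved b) k))
        carved-wheel≠hole a b k =
          subst (λ w → ¬ (ball w ≐ ball (hole (carved b) k)))
            (sym (carve-wheel (P (index a)) c lem))
            (carve-holes (P (index b)) c lem (λ h → ¬ (ball (wheel (P (index a))) ≐ ball h))
              (sound a ∘ proj₁) (wheel≠hole D (index a) (index b)) k)

        filled : Fin count → Cheese
        filled a = fill c (P (index a))

        -- The smaller wheel lies in a hole of the other piece, which was filled, so inside ball c.
        nested-filled-disjoint : ∀ a b → a ≢ b → ball (wheel (filled a)) ⊆ ball (wheel (filled b)) →
          ⟦ filled a ⟧ᶜ ⊥ ⟦ filled b ⟧ᶜ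
        nested-filled-disjoint a b a≢b Wa⊆Wb (ya , yb) =
          let l , Wa⊆h = wheel-inside-hole (P (index a)) (P (index b))
                           (disjoint D (index a) (index b) (a≢b ∘ injective)) Wa⊆Wb
          in sound a (∈-fill⇒hole-⊆ c (P (index b)) l yb (Wa⊆h (proj₁ ya)) ∘ Wa⊆h)

        filled-disjoint : ∀ a b → a ≢ b → ⟦ filled a ⟧ᶜ ⊥ ⟦ filled b ⟧ᶜ
        filled-disjoint a b a≢b (ya , yb) with comparable (proj₁ ya) (proj₁ yb)
        ... | inj₁ Wa⊆Wb = nested-filled-disjoint a b a≢b Wa⊆Wb (ya , yb)
        ... | inj₂ Wb⊆Wa = nested-filled-disjoint b a (a≢b ∘ sym) Wb⊆Wa (yb , ya)

        filled-wheel≠hole : ∀ a b k → ¬ (ball (wheel (filled a)) ≐ ball (hole (filled b) k))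
        filled-wheel≠hole a b =
          fill-holes c (P (index b)) (λ h → ¬ (ball (wheel (P (index a))) ≐ ball h))
            (wheel≠hole D (index a) (index b))

        Y⊆c∪filled : Y ⊆ ball c ∪ ⋃ (Fin count) (⟦_⟧ᶜ ∘ filled)
        Y⊆c∪filled {y} yY with proj₁ (covers D) yY
        ... | i , ys with lem {ball (wheel (P i)) ⊆ ball c}
        ...   | yes W⊆c = inj₁ (W⊆c (proj₁ ys))
        ...   | no W⊈c = let a , a↦i = complete W⊈c in
                inj₂ (a , ⊆-fill c (P (index a)) (subst (λ j → y ∈ ⟦ P j ⟧ᶜ) (sym a↦i) ys))

        filled⊆Y∪c : ⋃ (Fin count) (⟦_⟧ᶜ ∘ filled) ⊆ Y ∪ ball c
        filled⊆Y∪c (a , ya) =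
          Sum.map₁ (λ ys → proj₂ (covers D) (index a , ys)) (fill-⊆ c (P (index a)) ya)

      remove-ball : Decomposition (Y ∖ ball c)
      remove-ball = record
        { size = count
        ; piece = carved
        ; disjoint = λ a b a≢b (ya , yb) → disjoint D (index a) (index b) (a≢b ∘ injective)
                       (proj₁ (proj₁ (carved-≐ a) ya) , proj₁ (proj₁ (carved-≐ b) yb))
        ; wheel≠hole = carved-wheel≠hole
        ; covers = Y∖c⊆carved
                 , λ (a , ya) → let ys , y∉c = proj₁ (carved-≐ a) ya
                                in proj₂ (covers D) (index a , ys) , y∉c
        }
        where
        Y∖c⊆carved : Y ∖ ball c ⊆ ⋃ (Fin count) (⟦_⟧ᶜ ∘ carved)
        Y∖c⊆carved {y} (yY , y∉c) with proj₁ (covers D) yY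
        ... | i , ys = let a , a↦i = complete (λ W⊆c → y∉c (W⊆c (proj₁ ys))) in
          a , proj₂ (carved-≐ a) (subst (λ j → y ∈ ⟦ P j ⟧ᶜ) (sym a↦i) ys , y∉c)

      -- Fill the holes inside ball c; ball c becomes a new piece unless a filled piece contains it.
      add-ball : Decomposition (Y ∪ ball c)
      add-ball with lem {∃ λ a → ball c ⊆ ⟦ filled a ⟧ᶜ}
      ... | yes (a , c⊆a) = record
        { size = count ; piece = filled ; disjoint = filled-disjoint
        ; wheel≠hole = filled-wheel≠hole
        ; covers = Sum.[ Sum.[ inC , (λ y∈ → y∈) ]′ ∘ Y⊆c∪filled , inC ]′ , filled⊆Y∪c }
        where
        inC : ball c ⊆ ⋃ (Fin count) (⟦_⟧ᶜ ∘ filled)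
        inC yc = a , c⊆a yc
      ... | no uncovered = record
        { size = suc count
        ; piece = noHoles c ∷ filled
        ; disjoint = λ { zero zero 0≢0 → ⊥-elim (0≢0 refl)
                       ; zero (suc b) _ → c⊥filled b
                       ; (suc a) zero _ → c⊥filled a ∘ swap
                       ; (suc a) (suc b) a≢b → filled-disjoint a b (a≢b ∘ cong suc) }
        ; wheel≠hole = λ { _ zero ()
                         ; zero (suc b) k (_ , h⊆c) → fill-holes-outside c (P (index b)) k h⊆c
                         ; (suc a) (suc b) → filled-wheel≠hole a b }
        ; covers = Sum.[ Sum.[ inC , Product.map suc (λ y∈ → y∈) ]′ ∘ Y⊆c∪filled , inC ]′
                 , λ { (zero , yc , _) → inj₂ yc ; (suc a , ya) → filled⊆Y∪c (a , ya) }
        }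
        where
        inC : ball c ⊆ ⋃ (Fin (suc count)) (⟦_⟧ᶜ ∘ (noHoles c ∷ filled))
        inC yc = zero , proj₂ (noHoles-≐ c) yc
        c⊥filled : ∀ a → ⟦ noHoles c ⟧ᶜ ⊥ ⟦ filled a ⟧ᶜ
        c⊥filled a ((yc , _) , ya) with comparable (proj₁ ya) yc
        ... | inj₁ W⊆c = sound a W⊆c
        ... | inj₂ c⊆W = uncovered (a , λ zc → c⊆W zc , λ (k , zh) → hole⊈c zc k zh)
          where
          hole⊈c : ∀ {z} → z ∈ ball c → ∀ k → z ∉ ball (hole (filled a) k)
          hole⊈c zc k zh with comparable zh zc
          ... | inj₁ h⊆c = fill-holes-outside c (P (index a)) k h⊆c
          ... | inj₂ c⊆h = proj₂ ya (k , c⊆h yc)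

    module _ (universe : UniverseIsBall) where
      -- Peel off a minimal ball C of L: X meets C in all of C or in nothing, and off C it is
      -- determined by the remaining balls.
      decompose : ∀ m (L : Fin m → I) X → Determined L X → Decomposition X
      decompose zero L X det with lem {∃ λ x → x ∈ X}
      ... | yes (x , xX) =
            Decomposition-resp-≐ ((λ _ → det (λ ()) xX) , λ _ → proj₂ (proj₂ universe) _)
              (ball-decomposition (proj₁ universe))
      ... | no empty = Decomposition-resp-≐
              ((λ ()) , λ xX → ⊥-elim (empty (_ , xX)))
              (disjoint-balls-decomposition {0} (λ ()) λ ())
      decompose (suc m) L X det with minimal m L
      ... | j , minimalC = split-by-C (lem {∃ λ z → z ∈ ball C × z ∈ X})
        where
        C : I
        C = L j
        L′ : Fin m → I
        L′ = L ∘ punchIn j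
        Y : Pred 𝔘 0ℓ
        Y x = ∃ λ y → y ∈ X × y ∉ ball C × All (SameBalls y x) L′
        Y-determined : Determined L′ Y
        Y-determined x~x′ (y , yX , y∉C , y~x) = y , yX , y∉C , sameBalls-trans y~x x~x′
        DY : Decomposition Y
        DY = decompose m L′ Y Y-determined
        X∖C⊆Y : X ∖ ball C ⊆ Y
        X∖C⊆Y (xX , x∉C) = _ , xX , x∉C , λ _ → (λ x∈ → x∈) , (λ x∈ → x∈)
        Y∖C⊆X : Y ∖ ball C ⊆ X
        Y∖C⊆X ((y , yX , y∉C , y~x) , x∉C) = det (sameBalls-punchIn L j y∉C x∉C y~x) yX
        C-uniform : ∀ {x x′} → x ∈ ball C → x′ ∈ ball C → All (SameBalls x x′) L
        C-uniform xC x′C k = ⊆ xC x′C , ⊆ x′C xC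
          where
          ⊆ : ∀ {x x′} → x ∈ ball C → x′ ∈ ball C → x ∈ ball (L k) → x′ ∈ ball (L k)
          ⊆ xC x′C xk with comparable xC xk
          ... | inj₁ C⊆k = C⊆k x′C
          ... | inj₂ k⊆C = dne (λ x′∉k → minimalC k (k⊆C , λ C⊆k → x′∉k (C⊆k x′C)))
        split-by-C : Dec (∃ λ z → z ∈ ball C × z ∈ X) → Decomposition X
        split-by-C (yes (z , zC , zX)) = Decomposition-resp-≐ (Y∪C⊆X , X⊆Y∪C) (add-ball DY C)
          where
          Y∪C⊆X : Y ∪ ball C ⊆ X
          Y∪C⊆X (inj₂ xC) = det (C-uniform zC xC) zX
          Y∪C⊆X {x} (inj₁ xY) with lem {x ∈ ball C}
          ... | yes xC = Y∪C⊆X (inj₂ xC)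
          ... | no x∉C = Y∖C⊆X (xY , x∉C)
          X⊆Y∪C : X ⊆ Y ∪ ball C
          X⊆Y∪C {x} xX with lem {x ∈ ball C}
          ... | yes xC = inj₂ xC
          ... | no x∉C = inj₁ (X∖C⊆Y (xX , x∉C))
        split-by-C (no X∩C=∅) = Decomposition-resp-≐ (Y∖C⊆X , X⊆Y∖C) (remove-ball DY C)
          where
          X⊆Y∖C : X ⊆ Y ∖ ball C
          X⊆Y∖C xX = let x∉C = λ xC → X∩C=∅ (_ , xC , xX) in X∖C⊆Y (xX , x∉C) , x∉C

      unique-decomposition : UniqueDecomposition
      unique-decomposition X (e , X≐e) =
        Decomposition-resp-≐ (≐-sym X≐e) (decompose _ (atoms e) ⟦ e ⟧ᵉ (⟦⟧ᵉ-determined e)) ,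
        decomposition-unique

  incomparable-subfamily : ∀ {n} (bs : Fin n → I) → ∃₂ λ m (cs : Fin m → I) →
    (∀ k → ∃ λ l → cs k ≡ bs l) × Incomparable cs × ⋃Balls bs ⊆ ⋃Balls cs
  incomparable-subfamily {zero} bs = 0 , bs , (λ ()) , (λ ()) , λ x → x
  incomparable-subfamily {suc n} bs with lem {∃₂ λ i j → i ≢ j × ball (bs i) ⊆ ball (bs j)}
  ... | no none = suc n , bs , (_, refl) , (λ i j i≢j i⊆j → none (i , j , i≢j , i⊆j)) , λ x → x
  ... | yes (i , j , i≢j , i⊆j) with incomparable-subfamily (bs ∘ punchIn i)
  ...   | m , cs , sub , inc , ⊆cs =
    m , cs , (λ k → let l , cₖ≡bₗ = sub k in punchIn i l , cₖ≡bₗ) , inc , ⊆cs ∘ drop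
    where
    skip : ∀ {x l} → i ≢ l → x ∈ ball (bs l) → x ∈ ⋃Balls (bs ∘ punchIn i)
    skip i≢l xl = punchOut i≢l , subst (λ l → _ ∈ ball (bs l)) (sym (punchIn-punchOut i≢l)) xl
    drop : ⋃Balls bs ⊆ ⋃Balls (bs ∘ punchIn i)
    drop (k , xk) with k ≟ i
    ... | yes refl = skip i≢j (i⊆j xk)
    ... | no k≢i = skip (k≢i ∘ sym) xk

  IncomparablePacking : I → ∀ {m} → (Fin m → I) → Set
  IncomparablePacking a cs = (∀ k → ball (cs k) ⊂ ball a) × Incomparable cs × ball a ⊆ ⋃Balls cs

  module _ (nonempty : NonemptyBalls) where
    unpackable-if-no-packing :
      (∀ a m (cs : Fin (suc m) → I) → ¬ IncomparablePacking a cs) → Unpackable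
    unpackable-if-no-packing no-packing a n bs bs⊂a (a⊆⋃ , _) with incomparable-subfamily bs
    ... | zero , _ , _ , _ , ⊆cs with ⊆cs (a⊆⋃ (proj₂ (nonempty a)))
    ...   | () , _
    unpackable-if-no-packing no-packing a n bs bs⊂a (a⊆⋃ , _)
        | suc m , cs , sub , inc , ⊆cs =
      no-packing a m cs (cs⊂a , inc , ⊆cs ∘ a⊆⋃)
      where
      cs⊂a : ∀ k → ball (cs k) ⊂ ball a
      cs⊂a k = let l , cₖ≡bₗ = sub k in subst (λ b → ball b ⊂ ball a) (sym cₖ≡bₗ) (bs⊂a l)

    -- The packing presents ball (cs zero) both as a ∖ (cs 1 ∪ … ∪ cs m) and as cs zero.
    presentationUnique⇒unpackable : PresentationUnique → Unpackable
    presentationUnique⇒unpackable unique = unpackable-if-no-packing no-packing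
      where
      no-packing : ∀ a m (cs : Fin (suc m) → I) → ¬ IncomparablePacking a cs
      no-packing a m cs (cs⊂a , inc , a⊆⋃) = proj₂ (cs⊂a zero) (proj₁ (proj₁ wheels-and-holes))
        where
        cs-disjoint = incomparable⇒disjoint inc
        S : Cheese
        S = record { wheel = a ; nholes = m ; hole = cs ∘ suc ; proper = cs⊂a ∘ suc
                   ; incomp = λ j k j≢k → inc (suc j) (suc k) (j≢k ∘ suc-injective) }
        S≐cs₀ : ⟦ S ⟧ᶜ ≐ ⟦ noHoles (cs zero) ⟧ᶜ
        S≐cs₀ = (λ (xa , x∉h) → in-cs₀ x∉h (a⊆⋃ xa))
              , λ (x₀ , _) → proj₁ (cs⊂a zero) x₀
                           , λ (k , xk) → cs-disjoint zero (suc k) (λ ()) (x₀ , xk)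
          where
          in-cs₀ : ∀ {x} → x ∉ ⋃Balls (cs ∘ suc) → x ∈ ⋃Balls cs → x ∈ ⟦ noHoles (cs zero) ⟧ᶜ
          in-cs₀ _ (zero , x₀) = proj₂ (noHoles-≐ (cs zero)) x₀
          in-cs₀ x∉h (suc k , xk) = ⊥-elim (x∉h (k , xk))
        wheels-and-holes = unique S (noHoles (cs zero)) S≐cs₀
          (λ j k j≢k → cs-disjoint (suc j) (suc k) (j≢k ∘ suc-injective)) (λ ())

    -- The packing gives two decompositions of ball a: ball a itself and the balls cs k.
    uniqueDecomposition⇒unpackable : UniqueDecomposition → Unpackable
    uniqueDecomposition⇒unpackable unique = unpackable-if-no-packing no-packing
      where
      no-packing : ∀ a m (cs : Fin (suc m) → I) → ¬ IncomparablePacking a cs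
      no-packing a m cs (cs⊂a , inc , a⊆⋃) =
        let j , a≐csⱼ = proj₁ (proj₂ (unique (ball a) (atom a , ≐-refl)) whole parts) zero
        in proj₂ (cs⊂a j) (λ xa → proj₁ (proj₁ a≐csⱼ (proj₂ (noHoles-≐ a) xa)))
        where
        whole parts : Decomposition (ball a)
        whole = ball-decomposition a
        parts = Decomposition-resp-≐ ((λ (k , xk) → proj₁ (cs⊂a k) xk) , a⊆⋃)
          (disjoint-balls-decomposition cs (incomparable⇒disjoint inc))

theorem2p2 : ExcludedMiddle 0ℓ → {𝔘 I : Set} (ball : I → Pred 𝔘 0ℓ) →
    Balls.NonemptyBalls ball → Balls.Directed ball → Balls.UniverseIsBall ball →
    (Balls.Unpackable ball ⇔ Balls.CoverProperty ball)
    × (Balls.Unpackable ball ⇔ Balls.PresentationUnique ball)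
    × (Balls.Unpackable ball ⇔ Balls.UniqueDecomposition ball)
theorem2p2 lem ball nonempty directed universe =
  mk⇔ unpackable⇒cover cover⇒unpackable ,
  mk⇔ (presentation-unique ∘ unpackable⇒cover) (presentationUnique⇒unpackable nonempty) ,
  mk⇔ (λ unpackable → unique-decomposition (unpackable⇒cover unpackable) universe)
      (uniqueDecomposition⇒unpackable nonempty)
  where open DirectedBalls lem ball directed
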